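{- Let $w\in\mathcal{A}^*$ be a non-empty finite word whose fractionary root $z_w$ is a $c$-epichristoffel word. Then $w$ is a factor of some episturmian sequence.
   Context: $\mathcal{A}$ is a finite alphabet. For $w=w[0]\cdots w[n-1]$, an integer $p\geq 1$ is a period of $w$ if $w[i]=w[i+p]$ for all $0\le i<n-p$; the fractionary root $z_w$ of $w$ is the prefix of $w$ whose length is the smallest period $p\ge 1$ of $w$. For a finite word $u$, $u^{(+)}$ denotes the shortest palindrome having $u$ as prefix. An infinite word $s$ is standard episturmian if for every prefix $u$ of $s$, $u^{(+)}$ is a prefix of $s$; an infinite word is episturmian if it has the same set of factors as some standard episturmian sequence. For $a,b\in\mathcal{A}$: $\psi_a(a)=\overline{\psi}_a(a)=a$, $\psi_a(x)=ax$, $\overline{\psi}_a(x)=xa$ for letters $x\neq a$, and $\theta_{ab}$ swaps $a,b$ and fixes other letters. Episturmian morphisms are the compositions of these morphisms. A finite word is $c$-epichristoffel if it is the image of a letter under an episturmian morphism. -}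

module Defs where

open import Data.Nat using (ℕ; zero; suc; _+_; _≤_; _<_)
open import Data.Fin using (Fin)
open import Data.Fin.Properties using (_≟_)
open import Data.List using (List; []; _∷_; _++_; length; reverse; map; upTo; concatMap; take)
open import Data.Maybe using (Maybe; just; nothing)
open import Data.Product using (Σ; ∃; _×_; _,_)
open import Relation.Nullary using (yes; no)
open import Relation.Binary.PropositionalEquality using (_≡_)

-- The finite alphabet is Fin k (any finite alphabet, up to renaming).
Letter : ℕ → Set
Letter k = Fin k

Word : ℕ → Set
Word k = List (Letter k)

Seq : ℕ → Set
Seq k = ℕ → Letter k

at : {A : Set} → List A → ℕ → Maybe A
at []       _       = nothing
at (x ∷ xs) zero    = just x
at (x ∷ xs) (suc i) = at xs i

IsPeriod : {A : Set} → List A → ℕ → Set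
IsPeriod w p = 1 ≤ p × (∀ i → i + p < length w → at w i ≡ at w (i + p))

IsSmallestPeriod : {A : Set} → List A → ℕ → Set
IsSmallestPeriod w p = IsPeriod w p × (∀ q → IsPeriod w q → p ≤ q)

IsFractionaryRoot : {A : Set} → List A → List A → Set
IsFractionaryRoot w z = Σ ℕ λ p → IsSmallestPeriod w p × z ≡ take p w

IsPalindrome : {A : Set} → List A → Set
IsPalindrome p = reverse p ≡ p

IsPrefixOf : {A : Set} → List A → List A → Set
IsPrefixOf u v = ∃ λ r → u ++ r ≡ v

IsPalClosure : {A : Set} → List A → List A → Set
IsPalClosure u p =
  IsPalindrome p × IsPrefixOf u p ×
  (∀ q → IsPalindrome q → IsPrefixOf u q → length p ≤ length q)

segment : {k : ℕ} → Seq k → ℕ → ℕ → Word k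
segment s i n = map (λ j → s (i + j)) (upTo n)

IsFactorOfSeq : {k : ℕ} → Word k → Seq k → Set
IsFactorOfSeq w s = ∃ λ i → segment s i (length w) ≡ w

IsPrefixOfSeq : {k : ℕ} → Word k → Seq k → Set
IsPrefixOfSeq u s = segment s 0 (length u) ≡ u

IsStandardEpisturmian : {k : ℕ} → Seq k → Set
IsStandardEpisturmian s =
  ∀ n → ∃ λ p → IsPalClosure (segment s 0 n) p × IsPrefixOfSeq p s

IsEpisturmian : {k : ℕ} → Seq k → Set
IsEpisturmian {k} t = ∃ λ s → IsStandardEpisturmian s ×
  (∀ (w : Word k) → (IsFactorOfSeq w t → IsFactorOfSeq w s) × (IsFactorOfSeq w s → IsFactorOfSeq w t))

data Gen (k : ℕ) : Set where
  ψ  : Letter k → Gen k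
  ψ̄  : Letter k → Gen k
  θ  : Letter k → Letter k → Gen k

genLetter : {k : ℕ} → Gen k → Letter k → Word k
genLetter (ψ a) x with x ≟ a
... | yes _ = a ∷ []
... | no  _ = a ∷ x ∷ []
genLetter (ψ̄ a) x with x ≟ a
... | yes _ = a ∷ []
... | no  _ = x ∷ a ∷ []
genLetter (θ a b) x with x ≟ a
... | yes _ = b ∷ []
... | no  _ with x ≟ b
...   | yes _ = a ∷ []
...   | no  _ = x ∷ []

applyGen : {k : ℕ} → Gen k → Word k → Word k
applyGen g w = concatMap (genLetter g) w

applyMorphism : {k : ℕ} → List (Gen k) → Word k → Word k
applyMorphism []       w = w
applyMorphism (g ∷ gs) w = applyGen g (applyMorphism gs w)

IsCEpichristoffel : {k : ℕ} → Word k → Set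
IsCEpichristoffel {k} w = ∃ λ (f : List (Gen k)) → ∃ λ (a : Letter k) → applyMorphism f (a ∷ []) ≡ w

-- Call a sequence of words P₀ = ε, P_{i+1} = (P_i c_i)^(+) a palindromic
-- chain.  Its members are palindromes, each a prefix of the next, so they have a
-- limit s; the closure of every prefix of s is some P_i, hence s is standard
-- episturmian, and every factor of every P_i is a factor of s.
--
-- Chains are closed under the episturmian generators: renaming letters by θ_ab
-- maps a chain to a chain, and by Justin's formula
--   (ψ_x(P) x a)^(+) = ψ_x((P a)^(+)) x     (any word P, letters x, a)
-- the words ε, ψ_x(P_i) x form a chain as well.  Justin's formula is proved by
-- cutting a shorter palindromic extension of ψ_x(P) x a back to a factorisation
-- P a = V T with T a palindrome, which bounds how much the closure of P a adds.  By induction on the morphism, for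
-- every c-epichristoffel word y there is a chain in which every power y^n occurs
-- (for ψ̄_x one uses the conjugacy x ψ̄_x(v) = ψ_x(v) x).  Finally a word w with a
-- period p is a prefix of (w[0..p))^|w|, so w occurs in that chain too.

module Submission where

open import Defs
open import Data.Nat using (ℕ; zero; suc; _+_; _≤_; _<_; _≤′_; ≤′-refl; ≤′-step; z≤n; s≤s; _≤?_)
open import Data.Nat.Properties hiding (_≟_)
open import Algebra.Properties.CommutativeSemigroup +-commutativeSemigroup using (xy∙z≈xz∙y)
open import Data.Fin.Properties using (_≟_)
open import Data.Fin.Permutation.Components using (transpose; transpose-inverse)
open import Data.List using (List; []; _∷_; _++_; length; reverse; map; applyUpTo; take; drop; initLast; _∷ʳ′_)
open import Data.List.Properties
open import Data.Maybe using (just; fromMaybe)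
open import Data.Maybe.Properties using (just-injective)
open import Data.Product using (∃; ∃₂; _×_; _,_; proj₁; proj₂)
open import Data.Sum using (_⊎_; inj₁; inj₂)
open import Data.Empty using (⊥-elim)
open import Relation.Nullary using (yes; no; Dec)
open import Relation.Binary.PropositionalEquality

private variable
  A B : Set

++-cancel-≡length : ∀ (xs xs′ : List A) {ys ys′} → length xs ≡ length xs′ →
                    xs ++ ys ≡ xs′ ++ ys′ → xs ≡ xs′ × ys ≡ ys′
++-cancel-≡length []       []         _ e = refl , e
++-cancel-≡length (x ∷ xs) (x′ ∷ xs′) l e with ∷-injective e
... | refl , e′ with ++-cancel-≡length xs xs′ (suc-injective l) e′
... | refl , ys≡ys′ = refl , ys≡ys′

length-take≤ : ∀ n (xs : List A) → n ≤ length xs → length (take n xs) ≡ n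
length-take≤ n xs n≤ = trans (length-take n xs) (m≤n⇒m⊓n≡m n≤)

take-++ˡ : ∀ n (xs ys : List A) → n ≤ length xs → take n (xs ++ ys) ≡ take n xs
take-++ˡ zero    xs       ys _       = refl
take-++ˡ (suc n) (x ∷ xs) ys (s≤s h) = cong (x ∷_) (take-++ˡ n xs ys h)

length-snoc : ∀ (w : List A) c → length (w ++ c ∷ []) ≡ suc (length w)
length-snoc w c = trans (length-++ w) (+-comm (length w) 1)

at-++ˡ : ∀ (u v : List A) i → i < length u → at (u ++ v) i ≡ at u i
at-++ˡ (x ∷ u) v zero    _       = refl
at-++ˡ (x ∷ u) v (suc i) (s≤s h) = at-++ˡ u v i h

at-++ʳ : ∀ (u v : List A) j → at (u ++ v) (length u + j) ≡ at v j
at-++ʳ []      v j = refl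
at-++ʳ (x ∷ u) v j = at-++ʳ u v j

at-defined : ∀ (w : List A) i → i < length w → ∃ λ y → at w i ≡ just y
at-defined (x ∷ w) zero    _       = x , refl
at-defined (x ∷ w) (suc i) (s≤s h) = at-defined w i h

at-drop : ∀ p (w : List A) i → at (drop p w) i ≡ at w (i + p)
at-drop zero    w       i = cong (at w) (sym (+-identityʳ i))
at-drop (suc p) []      i = refl
at-drop (suc p) (x ∷ w) i = trans (at-drop p w i) (cong (at (x ∷ w)) (sym (+-suc i p)))

length-drop-bound : ∀ p (w : List A) i → i < length (drop p w) → i + p < length w
length-drop-bound zero    w       i h = subst (_< length w) (sym (+-identityʳ i)) h
length-drop-bound (suc p) (x ∷ w) i h = subst (_< suc (length w)) (sym (+-suc i p)) (s≤s (length-drop-bound p w i h))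

prefix-trans : ∀ {u v w : List A} → IsPrefixOf u v → IsPrefixOf v w → IsPrefixOf u w
prefix-trans {u = u} (r , refl) (r′ , refl) = r ++ r′ , sym (++-assoc u r r′)

prefix-length : ∀ {u v : List A} → IsPrefixOf u v → length u ≤ length v
prefix-length {u = u} (r , refl) = length-++-≤ˡ u

prefix-++ˡ : ∀ (z : List A) {u v} → IsPrefixOf u v → IsPrefixOf (z ++ u) (z ++ v)
prefix-++ˡ z {u} (r , refl) = r , ++-assoc z u r

prefix-of-++ : ∀ (u v : List A) {r t} → length u ≤ length v → u ++ r ≡ v ++ t → IsPrefixOf u v
prefix-of-++ []      v       _       _ = v , refl
prefix-of-++ (x ∷ u) (y ∷ v) (s≤s h) e with ∷-injective e
... | refl , e′ with prefix-of-++ u v h e′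
... | r , u++r≡v = r , cong (x ∷_) u++r≡v

prefix-from-at : ∀ (u v : List A) → (∀ i → i < length u → at u i ≡ at v i) → IsPrefixOf u v
prefix-from-at []      v       _ = v , refl
prefix-from-at (c ∷ u) []      h with h 0 (s≤s z≤n)
... | ()
prefix-from-at (c ∷ u) (d ∷ v) h with h 0 (s≤s z≤n)
... | refl with prefix-from-at u v (λ i i< → h (suc i) (s≤s i<))
... | r , u++r≡v = r , cong (c ∷_) u++r≡v

at-of-prefix : ∀ {u v : List A} {i} → IsPrefixOf u v → i < length u → at v i ≡ at u i
at-of-prefix {u = u} {i = i} (r , refl) = at-++ˡ u r i

Infix : List A → List A → Set
Infix u v = ∃₂ λ L M → v ≡ L ++ (u ++ M)

prefix-infix : ∀ {w u v : List A} → IsPrefixOf w u → Infix u v → Infix w v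
prefix-infix {w = w} (r , refl) (L , M , e) = L , r ++ M , trans e (cong (L ++_) (++-assoc w r M))

infix-snoc : ∀ {u v : List A} c → Infix u v → Infix u (v ++ c ∷ [])
infix-snoc {u = u} c (L , M , refl) =
  L , M ++ c ∷ [] , trans (++-assoc L (u ++ M) _) (cong (L ++_) (++-assoc u M _))

infix-cons : ∀ {u v : List A} c → Infix u v → Infix u (c ∷ v)
infix-cons c (L , M , refl) = c ∷ L , M , refl

palindrome-closure : ∀ {p : List A} → IsPalindrome p → IsPalClosure p p
palindrome-closure {p = p} pal = pal , ([] , ++-identityʳ p) , λ _ _ → prefix-length

palindrome-sandwich : ∀ (V T : List A) → IsPalindrome T → IsPalindrome (V ++ (T ++ reverse V))
palindrome-sandwich V T palT = begin
    reverse (V ++ (T ++ reverse V))          ≡⟨ reverse-++ V (T ++ reverse V) ⟩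
    reverse (T ++ reverse V) ++ reverse V    ≡⟨ cong (_++ reverse V) (reverse-++ T (reverse V)) ⟩
    (reverse (reverse V) ++ reverse T) ++ reverse V
      ≡⟨ cong₂ (λ s t → (s ++ t) ++ reverse V) (reverse-involutive V) palT ⟩
    (V ++ T) ++ reverse V                    ≡⟨ ++-assoc V T (reverse V) ⟩
    V ++ (T ++ reverse V)                    ∎
  where open ≡-Reasoning

palindrome-split : ∀ (U r : List A) → IsPalindrome (U ++ r) → length r ≤ length U →
                   r ≡ reverse (take (length r) U) × IsPalindrome (drop (length r) U)
palindrome-split U r pal r≤U = r-mirror , ++-cancelʳ r (reverse S) S S-r-pal
  where
  L S : List _
  L = take (length r) U
  S = drop (length r) U
  both-sides : reverse r ++ (reverse S ++ reverse L) ≡ L ++ (S ++ r)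
  both-sides = begin
    reverse r ++ (reverse S ++ reverse L) ≡⟨ cong (reverse r ++_) (sym (reverse-++ L S)) ⟩
    reverse r ++ reverse (L ++ S)         ≡⟨ cong (λ t → reverse r ++ reverse t) (take++drop≡id (length r) U) ⟩
    reverse r ++ reverse U                ≡⟨ sym (reverse-++ U r) ⟩
    reverse (U ++ r)                      ≡⟨ pal ⟩
    U ++ r                                ≡⟨ cong (_++ r) (sym (take++drop≡id (length r) U)) ⟩
    (L ++ S) ++ r                         ≡⟨ ++-assoc L S r ⟩
    L ++ (S ++ r)                         ∎
    where open ≡-Reasoning
  parts : reverse r ≡ L × reverse S ++ reverse L ≡ S ++ r
  parts = ++-cancel-≡length (reverse r) L
            (trans (length-reverse r) (sym (length-take≤ (length r) U r≤U))) both-sides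
  r-mirror : r ≡ reverse L
  r-mirror = trans (sym (reverse-involutive r)) (cong reverse (proj₁ parts))
  S-r-pal : reverse S ++ r ≡ S ++ r
  S-r-pal = trans (cong (reverse S ++_) r-mirror) (proj₂ parts)

last-split : ∀ (L S W : List A) e → L ++ S ≡ W ++ e ∷ [] → 0 < length S →
             ∃ λ S₀ → S ≡ S₀ ++ e ∷ [] × L ++ S₀ ≡ W
last-split L S W e eq S-pos with initLast S
... | [] = ⊥-elim (<-irrefl refl S-pos)
... | S₀ ∷ʳ′ e′ with ∷ʳ-injective (L ++ S₀) W (trans (++-assoc L S₀ (e′ ∷ [])) eq)
... | L++S₀≡W , refl = S₀ , refl , L++S₀≡W

palindromic-suffix-head : ∀ (L S W : List A) e → L ++ S ≡ W ++ e ∷ [] → 0 < length S →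
                          IsPalindrome S → ∃ λ S₁ → S ≡ e ∷ S₁
palindromic-suffix-head L S W e eq S-pos S-pal with last-split L S W e eq S-pos
... | S₀ , refl , _ = reverse S₀ , trans (sym S-pal) (reverse-++ S₀ (e ∷ []))

-- If p = u r is the closure of u and u = V T with T a palindrome, then the extension r
-- mirrors a prefix of V: V T (reverse V) is a palindrome beginning with u, so |r| ≤ |V|.
closure-extension : ∀ {u p r : List A} V T → IsPalClosure u p → u ++ r ≡ p →
                    u ≡ V ++ T → IsPalindrome T → r ≡ reverse (take (length r) V)
closure-extension {u = u} {p} {r} V T (p-pal , _ , p-min) u++r≡p u≡VT T-pal = begin
    r                                   ≡⟨ proj₁ (palindrome-split u r u++r-pal r≤u) ⟩
    reverse (take (length r) u)         ≡⟨ cong (λ t → reverse (take (length r) t)) u≡VT ⟩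
    reverse (take (length r) (V ++ T))  ≡⟨ cong reverse (take-++ˡ (length r) V T r≤V) ⟩
    reverse (take (length r) V)         ∎
  where
  open ≡-Reasoning
  u++r-pal : IsPalindrome (u ++ r)
  u++r-pal = subst IsPalindrome (sym u++r≡p) p-pal
  Q : List _
  Q = V ++ (T ++ reverse V)
  u-prefix-Q : IsPrefixOf u Q
  u-prefix-Q = reverse V , trans (cong (_++ reverse V) u≡VT) (++-assoc V T (reverse V))
  p≤Q : length u + length r ≤ length u + length V
  p≤Q = subst₂ _≤_ (trans (cong length (sym u++r≡p)) (length-++ u))
    (trans (cong length (sym (proj₂ u-prefix-Q))) (trans (length-++ u) (cong (length u +_) (length-reverse V))))
    (p-min Q (palindrome-sandwich V T T-pal) u-prefix-Q)
  r≤V : length r ≤ length V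
  r≤V = +-cancelˡ-≤ (length u) _ _ p≤Q
  r≤u : length r ≤ length u
  r≤u = ≤-trans r≤V (subst (length V ≤_) (cong length (sym u≡VT)) (length-++-≤ˡ V))

closure-map : (f : A → B) (g : B → A) → (∀ y → g (f y) ≡ y) →
              ∀ {u p} → IsPalClosure u p → IsPalClosure (map f u) (map f p)
closure-map f g g∘f {u} {p} (p-pal , (r , u++r≡p) , p-min) =
  map-palindrome f p-pal , (map f r , trans (sym (map-++ f u r)) (cong (map f) u++r≡p)) , minimal
  where
  map-palindrome : ∀ {C D : Set} (h : C → D) {q} → IsPalindrome q → IsPalindrome (map h q)
  map-palindrome h {q} q-pal = trans (sym (reverse-map h q)) (cong (map h) q-pal)
  g-f-inverse : ∀ v → map g (map f v) ≡ v
  g-f-inverse v = trans (sym (map-∘ v)) (trans (map-cong g∘f v) (map-id v))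
  minimal : ∀ q → IsPalindrome q → IsPrefixOf (map f u) q → length (map f p) ≤ length q
  minimal q q-pal (r′ , fu++r′≡q) = subst₂ _≤_ (sym (length-map f p)) (length-map g q)
    (p-min (map g q) (map-palindrome g q-pal)
      (map g r′ , trans (cong (_++ map g r′) (sym (g-f-inverse u)))
                        (trans (sym (map-++ g (map f u) r′)) (cong (map g) fu++r′≡q))))

module PsiMorphism {k : ℕ} (x : Letter k) where

  Ψ Ψ̄ : Word k → Word k
  Ψ  = applyGen (ψ x)
  Ψ̄ = applyGen (ψ̄ x)

  Ψ-++ : ∀ u v → Ψ (u ++ v) ≡ Ψ u ++ Ψ v
  Ψ-++ = concatMap-++ (genLetter (ψ x))

  ψ-letter-x : ∀ {c} → c ≡ x → genLetter (ψ x) c ≡ x ∷ []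
  ψ-letter-x {c} c≡x with c ≟ x
  ... | yes _   = refl
  ... | no c≢x = ⊥-elim (c≢x c≡x)

  ψ-letter-other : ∀ {c} → c ≢ x → genLetter (ψ x) c ≡ x ∷ c ∷ []
  ψ-letter-other {c} c≢x with c ≟ x
  ... | yes c≡x = ⊥-elim (c≢x c≡x)
  ... | no _    = refl

  Ψ-conjugate : ∀ v → x ∷ Ψ̄ v ≡ Ψ v ++ x ∷ []
  Ψ-conjugate []      = refl
  Ψ-conjugate (c ∷ v) with c ≟ x
  ... | yes _ = cong (x ∷_) (Ψ-conjugate v)
  ... | no _  = cong (λ t → x ∷ c ∷ t) (Ψ-conjugate v)

  reverse-Ψ̄ : ∀ v → reverse (Ψ̄ v) ≡ Ψ (reverse v)
  reverse-Ψ̄ []      = refl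
  reverse-Ψ̄ (c ∷ v) = begin
    reverse (genLetter (ψ̄ x) c ++ Ψ̄ v)           ≡⟨ reverse-++ (genLetter (ψ̄ x) c) (Ψ̄ v) ⟩
    reverse (Ψ̄ v) ++ reverse (genLetter (ψ̄ x) c) ≡⟨ cong₂ _++_ (reverse-Ψ̄ v) (reverse-letter c) ⟩
    Ψ (reverse v) ++ genLetter (ψ x) c            ≡⟨ cong (Ψ (reverse v) ++_) (sym (++-identityʳ _)) ⟩
    Ψ (reverse v) ++ Ψ (c ∷ [])                   ≡⟨ sym (Ψ-++ (reverse v) (c ∷ [])) ⟩
    Ψ (reverse v ++ c ∷ [])                       ≡⟨ cong Ψ (sym (unfold-reverse c v)) ⟩
    Ψ (reverse (c ∷ v))                           ∎
    where
    open ≡-Reasoning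
    reverse-letter : ∀ c → reverse (genLetter (ψ̄ x) c) ≡ genLetter (ψ x) c
    reverse-letter c with c ≟ x
    ... | yes _ = refl
    ... | no _  = refl

  reverse-Ψx : ∀ T → reverse (Ψ T ++ x ∷ []) ≡ Ψ (reverse T) ++ x ∷ []
  reverse-Ψx T = begin
    reverse (Ψ T ++ x ∷ [])    ≡⟨ cong reverse (sym (Ψ-conjugate T)) ⟩
    reverse (x ∷ Ψ̄ T)         ≡⟨ unfold-reverse x (Ψ̄ T) ⟩
    reverse (Ψ̄ T) ++ x ∷ []   ≡⟨ cong (_++ x ∷ []) (reverse-Ψ̄ T) ⟩
    Ψ (reverse T) ++ x ∷ []    ∎
    where open ≡-Reasoning

  Ψ-cons-x : ∀ {c} V → c ≡ x → Ψ (c ∷ V) ≡ x ∷ Ψ V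
  Ψ-cons-x V c≡x = cong (_++ Ψ V) (ψ-letter-x c≡x)

  Ψ-cons-other : ∀ {c} V → c ≢ x → Ψ (c ∷ V) ≡ x ∷ c ∷ Ψ V
  Ψ-cons-other V c≢x = cong (_++ Ψ V) (ψ-letter-other c≢x)

  Ψ-head : ∀ T {d B} → Ψ T ≡ d ∷ B → d ≡ x
  Ψ-head (c ∷ T) e with c ≟ x
  ... | yes _ = sym (∷-injectiveˡ e)
  ... | no _  = sym (∷-injectiveˡ e)

  Ψ-nonempty : ∀ c u → Ψ (c ∷ u) ≢ []
  Ψ-nonempty c u e with c ≟ x
  Ψ-nonempty c u () | yes _
  Ψ-nonempty c u () | no _

  Ψ-injective : ∀ u v → Ψ u ≡ Ψ v → u ≡ v
  Ψ-injective []      []      _ = refl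
  Ψ-injective []      (d ∷ v) e = ⊥-elim (Ψ-nonempty d v (sym e))
  Ψ-injective (c ∷ u) []      e = ⊥-elim (Ψ-nonempty c u e)
  Ψ-injective (c ∷ u) (d ∷ v) e with c ≟ x | d ≟ x
  ... | yes c≡x | yes d≡x = cong₂ _∷_ (trans c≡x (sym d≡x)) (Ψ-injective u v (∷-injectiveʳ e))
  ... | no _    | no _    = cong₂ _∷_ (∷-injectiveˡ (∷-injectiveʳ e)) (Ψ-injective u v (∷-injectiveʳ (∷-injectiveʳ e)))
  ... | yes _   | no d≢x  = ⊥-elim (d≢x (Ψ-head u (∷-injectiveʳ e)))
  ... | no c≢x  | yes _   = ⊥-elim (c≢x (Ψ-head v (sym (∷-injectiveʳ e))))

  Ψx-palindrome : ∀ T → IsPalindrome T → IsPalindrome (Ψ T ++ x ∷ [])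
  Ψx-palindrome T T-pal = trans (reverse-Ψx T) (cong (λ t → Ψ t ++ x ∷ []) T-pal)

  Ψx-palindrome⁻¹ : ∀ T → IsPalindrome (Ψ T ++ x ∷ []) → IsPalindrome T
  Ψx-palindrome⁻¹ T pal =
    Ψ-injective (reverse T) T (++-cancelʳ (x ∷ []) _ _ (trans (sym (reverse-Ψx T)) pal))

  length-Ψ-++ : ∀ u v → length (Ψ (u ++ v)) ≡ length (Ψ u) + length (Ψ v)
  length-Ψ-++ u v = trans (cong length (Ψ-++ u v)) (length-++ (Ψ u))

  length-Ψ-reverse : ∀ v → length (Ψ (reverse v)) ≡ length (Ψ v)
  length-Ψ-reverse v = begin
    length (Ψ (reverse v))    ≡⟨ cong length (sym (reverse-Ψ̄ v)) ⟩
    length (reverse (Ψ̄ v))   ≡⟨ length-reverse (Ψ̄ v) ⟩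
    length (Ψ̄ v)             ≡⟨ suc-injective (trans (cong length (Ψ-conjugate v)) (length-snoc (Ψ v) x)) ⟩
    length (Ψ v)              ∎
    where open ≡-Reasoning

  length-Ψ-mirror-prefix : ∀ n V → length (Ψ (reverse (take n V))) ≤ length (Ψ V)
  length-Ψ-mirror-prefix n V = begin
    length (Ψ (reverse (take n V)))               ≡⟨ length-Ψ-reverse (take n V) ⟩
    length (Ψ (take n V))                         ≤⟨ m≤m+n _ _ ⟩
    length (Ψ (take n V)) + length (Ψ (drop n V)) ≡⟨ sym (length-Ψ-++ (take n V) (drop n V)) ⟩
    length (Ψ (take n V ++ drop n V))             ≡⟨ cong (λ t → length (Ψ t)) (take++drop≡id n V) ⟩
    length (Ψ V)                                  ∎
    where open ≤-Reasoning

  -- Where a factorisation ψ_x(Y) = L M can cut: between the images of two letters of Y,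
  -- or right after the x of the image x d of a letter d ≠ x.
  Cut : Word k → Word k → Word k → Set
  Cut Y L M = ∃₂ λ V T → Y ≡ V ++ T ×
    ((L ≡ Ψ V × M ≡ Ψ T) ⊎
     (L ≡ Ψ V ++ x ∷ [] × x ∷ M ≡ Ψ T × ∃₂ λ d B → d ≢ x × M ≡ d ∷ B))

  Cut-cons : ∀ {c Y L M} → Cut Y L M → Cut (c ∷ Y) (genLetter (ψ x) c ++ L) M
  Cut-cons {c} (V , T , Y≡VT , inj₁ (L≡ΨV , M≡ΨT)) =
    c ∷ V , T , cong (c ∷_) Y≡VT , inj₁ (cong (genLetter (ψ x) c ++_) L≡ΨV , M≡ΨT)
  Cut-cons {c} (V , T , Y≡VT , inj₂ (L≡ΨVx , rest)) =
    c ∷ V , T , cong (c ∷_) Y≡VT ,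
    inj₂ (trans (cong (genLetter (ψ x) c ++_) L≡ΨVx) (sym (++-assoc (genLetter (ψ x) c) (Ψ V) (x ∷ []))) , rest)

  mutual
    Ψ-cut : ∀ Y L M → Ψ Y ≡ L ++ M → Cut Y L M
    Ψ-cut Y       []      M e = [] , Y , refl , inj₁ (refl , sym e)
    Ψ-cut []      (l ∷ L) M ()
    Ψ-cut (c ∷ Y) (l ∷ L) M e = Ψ-cut-cons (c ≟ x) Y L M e

    Ψ-cut-cons : ∀ {c l} → Dec (c ≡ x) → ∀ Y L M → Ψ (c ∷ Y) ≡ l ∷ (L ++ M) → Cut (c ∷ Y) (l ∷ L) M
    Ψ-cut-cons {c} (yes c≡x) Y L M e with ∷-injective (trans (sym (Ψ-cons-x Y c≡x)) e)
    ... | refl , ΨY≡LM =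
      subst (λ G → Cut (c ∷ Y) (G ++ L) M) (ψ-letter-x c≡x) (Cut-cons (Ψ-cut Y L M ΨY≡LM))
    Ψ-cut-cons {c} (no c≢x) Y [] M e with ∷-injective (trans (sym (Ψ-cons-other Y c≢x)) e)
    ... | refl , refl = [] , c ∷ Y , refl , inj₂ (refl , sym (Ψ-cons-other Y c≢x) , c , Ψ Y , c≢x , refl)
    Ψ-cut-cons {c} (no c≢x) Y (l′ ∷ L) M e with ∷-injective (trans (sym (Ψ-cons-other Y c≢x)) e)
    ... | refl , e′ with ∷-injective e′
    ... | refl , ΨY≡LM =
      subst (λ G → Cut (c ∷ Y) (G ++ L) M) (ψ-letter-other c≢x) (Cut-cons (Ψ-cut Y L M ΨY≡LM))

module Justin {k : ℕ} (x : Letter k) (P : Word k) (a : Letter k) (P⁺ : Word k)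
              (P⁺-closure : IsPalClosure (P ++ a ∷ []) P⁺) where
  open PsiMorphism x

  Y : Word k
  Y = P ++ a ∷ []

  ext : Word k
  ext = proj₁ (proj₁ (proj₂ P⁺-closure))

  Y-ext : Y ++ ext ≡ P⁺
  Y-ext = proj₂ (proj₁ (proj₂ P⁺-closure))

  U R : Word k
  U = (Ψ P ++ x ∷ []) ++ a ∷ []
  R = Ψ P⁺ ++ x ∷ []

  ΨY : Ψ Y ≡ Ψ P ++ genLetter (ψ x) a
  ΨY = trans (Ψ-++ P (a ∷ [])) (cong (Ψ P ++_) (++-identityʳ _))

  U-when-x : a ≡ x → U ≡ Ψ Y ++ x ∷ []
  U-when-x a≡x = begin
    (Ψ P ++ x ∷ []) ++ a ∷ []             ≡⟨ cong (λ t → (Ψ P ++ x ∷ []) ++ t ∷ []) a≡x ⟩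
    (Ψ P ++ x ∷ []) ++ x ∷ []             ≡⟨ cong (λ t → (Ψ P ++ t) ++ x ∷ []) (sym (ψ-letter-x a≡x)) ⟩
    (Ψ P ++ genLetter (ψ x) a) ++ x ∷ []  ≡⟨ cong (_++ x ∷ []) (sym ΨY) ⟩
    Ψ Y ++ x ∷ []                         ∎
    where open ≡-Reasoning

  U-when-other : a ≢ x → U ≡ Ψ Y
  U-when-other a≢x = begin
    (Ψ P ++ x ∷ []) ++ a ∷ []  ≡⟨ ++-assoc (Ψ P) (x ∷ []) (a ∷ []) ⟩
    Ψ P ++ x ∷ a ∷ []          ≡⟨ cong (Ψ P ++_) (sym (ψ-letter-other a≢x)) ⟩
    Ψ P ++ genLetter (ψ x) a   ≡⟨ sym ΨY ⟩
    Ψ Y                        ∎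
    where open ≡-Reasoning

  R-split : Ψ Y ++ (Ψ ext ++ x ∷ []) ≡ R
  R-split = begin
    Ψ Y ++ (Ψ ext ++ x ∷ [])  ≡⟨ sym (++-assoc (Ψ Y) (Ψ ext) (x ∷ [])) ⟩
    (Ψ Y ++ Ψ ext) ++ x ∷ []  ≡⟨ cong (_++ x ∷ []) (sym (Ψ-++ Y ext)) ⟩
    Ψ (Y ++ ext) ++ x ∷ []    ≡⟨ cong (λ t → Ψ t ++ x ∷ []) Y-ext ⟩
    R                         ∎
    where open ≡-Reasoning

  R-palindrome : IsPalindrome R
  R-palindrome = Ψx-palindrome P⁺ (proj₁ P⁺-closure)

  U-prefix-R : IsPrefixOf U R
  U-prefix-R with a ≟ x
  ... | yes a≡x = Ψ̄ ext , (begin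
    U ++ Ψ̄ ext                ≡⟨ cong (_++ Ψ̄ ext) (U-when-x a≡x) ⟩
    (Ψ Y ++ x ∷ []) ++ Ψ̄ ext  ≡⟨ ++-assoc (Ψ Y) (x ∷ []) (Ψ̄ ext) ⟩
    Ψ Y ++ (x ∷ Ψ̄ ext)        ≡⟨ cong (Ψ Y ++_) (Ψ-conjugate ext) ⟩
    Ψ Y ++ (Ψ ext ++ x ∷ [])   ≡⟨ R-split ⟩
    R                          ∎)
    where open ≡-Reasoning
  ... | no a≢x = Ψ ext ++ x ∷ [] , trans (cong (_++ (Ψ ext ++ x ∷ [])) (U-when-other a≢x)) R-split

  R-length : length R ≡ length (Ψ Y) + length (Ψ ext) + 1
  R-length = trans (cong length (sym R-split))
    (trans (length-++ (Ψ Y)) (trans (cong (length (Ψ Y) +_) (length-++ (Ψ ext)))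
                                    (sym (+-assoc (length (Ψ Y)) (length (Ψ ext)) 1))))

  -- Whenever Y = V T with T a palindrome, R is at most |ψ_x(Y)| + |ψ_x(V)| + 1 long,
  -- because ext mirrors a prefix of V.
  R-bound : ∀ V T → Y ≡ V ++ T → IsPalindrome T → length R ≤ length (Ψ Y) + length (Ψ V) + 1
  R-bound V T Y≡VT T-pal = begin
    length R                                     ≡⟨ R-length ⟩
    length (Ψ Y) + length (Ψ ext) + 1            ≡⟨ cong (λ t → length (Ψ Y) + length (Ψ t) + 1) ext-mirror ⟩
    length (Ψ Y) + length (Ψ (reverse (take (length ext) V))) + 1
      ≤⟨ +-monoˡ-≤ 1 (+-monoʳ-≤ (length (Ψ Y)) (length-Ψ-mirror-prefix (length ext) V)) ⟩
    length (Ψ Y) + length (Ψ V) + 1              ∎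
    where
    open ≤-Reasoning
    ext-mirror : ext ≡ reverse (take (length ext) V)
    ext-mirror = closure-extension V T P⁺-closure Y-ext Y≡VT T-pal

  U-length : length U ≡ length (Ψ P) + 2
  U-length = trans (length-++ (Ψ P ++ x ∷ []))
                   (trans (cong (_+ 1) (length-++ (Ψ P))) (+-assoc (length (Ψ P)) 1 1))

  ΨY≤U : length (Ψ Y) ≤ length U
  ΨY≤U with a ≟ x
  ... | yes a≡x = subst (length (Ψ Y) ≤_) (cong length (sym (U-when-x a≡x))) (length-++-≤ˡ (Ψ Y))
  ... | no a≢x  = ≤-reflexive (cong length (sym (U-when-other a≢x)))

  long-extension : ∀ (r : Word k) → length U ≤ length r → length R ≤ length U + length r
  long-extension r U≤r = begin
    length R                             ≤⟨ R-bound P (a ∷ []) refl refl ⟩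
    length (Ψ Y) + length (Ψ P) + 1      ≡⟨ +-assoc (length (Ψ Y)) (length (Ψ P)) 1 ⟩
    length (Ψ Y) + (length (Ψ P) + 1)    ≤⟨ +-mono-≤ ΨY≤U ΨP<U ⟩
    length U + length U                  ≤⟨ +-monoʳ-≤ (length U) U≤r ⟩
    length U + length r                  ∎
    where
    open ≤-Reasoning
    ΨP<U : length (Ψ P) + 1 ≤ length U
    ΨP<U = subst (length (Ψ P) + 1 ≤_) (sym U-length) (+-monoʳ-≤ (length (Ψ P)) (s≤s z≤n))

  -- A palindrome extending U and shorter than 2|U| is governed by a non-empty palindromic
  -- suffix S of U = L S; cutting ψ_x(Y) at L yields Y = V T with T a palindrome.
  suffix-when-x : a ≡ x → ∀ L S → L ++ S ≡ U → IsPalindrome S → 0 < length S →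
                  length R ≤ length U + length L
  suffix-when-x a≡x L S LS≡U S-pal S-pos with last-split L S (Ψ Y) x (trans LS≡U (U-when-x a≡x)) S-pos
  ... | S₀ , S≡S₀x , LS₀≡ΨY = from-cut (Ψ-cut Y L S₀ (sym LS₀≡ΨY))
    where
    from-cut : Cut Y L S₀ → length R ≤ length U + length L
    from-cut (V , T , Y≡VT , inj₁ (L≡ΨV , S₀≡ΨT)) = begin
      length R                          ≤⟨ R-bound V T Y≡VT T-pal ⟩
      length (Ψ Y) + length (Ψ V) + 1   ≡⟨ xy∙z≈xz∙y (length (Ψ Y)) (length (Ψ V)) 1 ⟩
      length (Ψ Y) + 1 + length (Ψ V)   ≡⟨ cong₂ _+_ (sym U-length-x) (cong length (sym L≡ΨV)) ⟩
      length U + length L               ∎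
      where
      open ≤-Reasoning
      T-pal : IsPalindrome T
      T-pal = Ψx-palindrome⁻¹ T (subst IsPalindrome (trans S≡S₀x (cong (_++ x ∷ []) S₀≡ΨT)) S-pal)
      U-length-x : length U ≡ length (Ψ Y) + 1
      U-length-x = trans (cong length (U-when-x a≡x)) (length-++ (Ψ Y))
    from-cut (_ , _ , _ , inj₂ (_ , _ , d , B , d≢x , S₀≡dB)) =
      ⊥-elim (d≢x (∷-injectiveˡ (trans (sym S≡dBx) (proj₂ S-starts-with-x))))
      where
      S≡dBx : S ≡ d ∷ (B ++ x ∷ [])
      S≡dBx = trans S≡S₀x (cong (_++ x ∷ []) S₀≡dB)
      S-starts-with-x : ∃ λ S₁ → S ≡ x ∷ S₁
      S-starts-with-x = palindromic-suffix-head L S (Ψ Y) x (trans LS≡U (U-when-x a≡x)) S-pos S-pal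

  suffix-when-other : a ≢ x → ∀ L S → L ++ S ≡ U → IsPalindrome S → 0 < length S →
                      length R ≤ length U + length L
  suffix-when-other a≢x L S LS≡U S-pal S-pos = from-cut (Ψ-cut Y L S (trans (sym (U-when-other a≢x)) (sym LS≡U)))
    where
    from-cut : Cut Y L S → length R ≤ length U + length L
    from-cut (_ , T , _ , inj₁ (_ , S≡ΨT)) = ⊥-elim (a≢x (Ψ-head T (trans (sym S≡ΨT) (proj₂ S-starts-with-a))))
      where
      S-starts-with-a : ∃ λ S₁ → S ≡ a ∷ S₁
      S-starts-with-a = palindromic-suffix-head L S (Ψ P ++ x ∷ []) a LS≡U S-pos S-pal
    from-cut (V , T , Y≡VT , inj₂ (L≡ΨVx , xS≡ΨT , _)) = begin
      length R                            ≤⟨ R-bound V T Y≡VT T-pal ⟩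
      length (Ψ Y) + length (Ψ V) + 1     ≡⟨ +-assoc (length (Ψ Y)) (length (Ψ V)) 1 ⟩
      length (Ψ Y) + (length (Ψ V) + 1)   ≡⟨ cong₂ _+_ (cong length (sym (U-when-other a≢x))) (sym L-length) ⟩
      length U + length L                 ∎
      where
      open ≤-Reasoning
      T-pal : IsPalindrome T
      T-pal = Ψx-palindrome⁻¹ T (subst IsPalindrome (cong (_++ x ∷ []) xS≡ΨT)
                                       (palindrome-sandwich (x ∷ []) S S-pal))
      L-length : length L ≡ length (Ψ V) + 1
      L-length = trans (cong length L≡ΨVx) (length-++ (Ψ V))

  R-minimal : ∀ q → IsPalindrome q → IsPrefixOf U q → length R ≤ length q
  R-minimal .(U ++ r) q-pal (r , refl) =
    subst (length R ≤_) (sym (length-++ U)) (by-length (length U ≤? length r))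
    where
    by-length : Dec (length U ≤ length r) → length R ≤ length U + length r
    by-length (yes U≤r) = long-extension r U≤r
    by-length (no U≰r)  = subst (λ n → length R ≤ length U + n) L-length (short (a ≟ x))
      where
      r<U : length r < length U
      r<U = ≰⇒> U≰r
      L S : Word k
      L = take (length r) U
      S = drop (length r) U
      L-length : length L ≡ length r
      L-length = length-take≤ (length r) U (<⇒≤ r<U)
      S-pal : IsPalindrome S
      S-pal = proj₂ (palindrome-split U r q-pal (<⇒≤ r<U))
      S-pos : 0 < length S
      S-pos = subst (0 <_) (sym (length-drop (length r) U)) (m<n⇒0<n∸m r<U)
      short : Dec (a ≡ x) → length R ≤ length U + length L
      short (yes a≡x) = suffix-when-x a≡x L S (take++drop≡id (length r) U) S-pal S-pos
      short (no a≢x)  = suffix-when-other a≢x L S (take++drop≡id (length r) U) S-pal S-pos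

  justin : IsPalClosure U R
  justin = R-palindrome , U-prefix-R , R-minimal

at-applyUpTo : ∀ (f : ℕ → A) n j → j < n → at (applyUpTo f n) j ≡ just (f j)
at-applyUpTo f (suc n) zero    _       = refl
at-applyUpTo f (suc n) (suc j) (s≤s h) = at-applyUpTo (λ i → f (suc i)) n j h

applyUpTo-from-at : ∀ (f : ℕ → A) w → (∀ j → j < length w → at w j ≡ just (f j)) →
                    applyUpTo f (length w) ≡ w
applyUpTo-from-at f []      _ = refl
applyUpTo-from-at f (c ∷ w) h =
  cong₂ _∷_ (just-injective (sym (h 0 (s≤s z≤n))))
            (applyUpTo-from-at (λ i → f (suc i)) w (λ j j< → h (suc j) (s≤s j<)))

segment≡applyUpTo : ∀ {k} (t : Seq k) i n → segment t i n ≡ applyUpTo (λ j → t (i + j)) n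
segment≡applyUpTo t i n = map-applyUpTo (λ j → j) (λ j → t (i + j)) n

length-segment : ∀ {k} (t : Seq k) i n → length (segment t i n) ≡ n
length-segment t i n = trans (cong length (segment≡applyUpTo t i n)) (length-applyUpTo _ n)

at-segment : ∀ {k} (t : Seq k) i n j → j < n → at (segment t i n) j ≡ just (t (i + j))
at-segment t i n j j<n = trans (cong (λ s → at s j) (segment≡applyUpTo t i n)) (at-applyUpTo _ n j j<n)

segment-from-at : ∀ {k} (t : Seq k) i (w : Word k) →
                  (∀ j → j < length w → at w j ≡ just (t (i + j))) → segment t i (length w) ≡ w
segment-from-at t i w h = trans (segment≡applyUpTo t i (length w)) (applyUpTo-from-at _ w h)

record PalChain (k : ℕ) : Set where
  field
    P    : ℕ → Word k
    c    : ℕ → Letter k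
    P₀   : P 0 ≡ []
    step : ∀ i → IsPalClosure (P i ++ c i ∷ []) (P (suc i))

module ChainLimit {k : ℕ} (K : PalChain k) where
  open PalChain K

  extends : ∀ i → IsPrefixOf (P i ++ c i ∷ []) (P (suc i))
  extends i = proj₁ (proj₂ (step i))

  monotone : ∀ {i j} → i ≤′ j → IsPrefixOf (P i) (P j)
  monotone ≤′-refl         = [] , ++-identityʳ _
  monotone (≤′-step i≤′j) = prefix-trans (monotone i≤′j) (prefix-trans (_ ∷ [] , refl) (extends _))

  grows : ∀ i → length (P i) < length (P (suc i))
  grows i = subst (_≤ length (P (suc i))) (length-snoc (P i) (c i)) (prefix-length (extends i))

  length-lower : ∀ i → i ≤ length (P i)
  length-lower zero    = z≤n
  length-lower (suc i) = ≤-trans (s≤s (length-lower i)) (grows i)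

  agree : ∀ m m′ j → j < length (P m) → j < length (P m′) → at (P m) j ≡ at (P m′) j
  agree m m′ j h h′ with ≤-total m m′
  ... | inj₁ m≤m′ = sym (at-of-prefix (monotone (≤⇒≤′ m≤m′)) h)
  ... | inj₂ m′≤m = at-of-prefix (monotone (≤⇒≤′ m′≤m)) h′

  -- Position n is settled by P_{n+1}, which is long enough to contain it.
  limit : Seq k
  limit n = fromMaybe (c 0) (at (P (suc n)) n)

  P-reads-limit : ∀ m j → j < length (P m) → at (P m) j ≡ just (limit j)
  P-reads-limit m j j<Pm with at-defined (P (suc j)) j (length-lower (suc j))
  ... | y , at≡y = begin
    at (P m) j        ≡⟨ agree m (suc j) j j<Pm (length-lower (suc j)) ⟩
    at (P (suc j)) j  ≡⟨ at≡y ⟩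
    just y            ≡⟨ cong (λ t → just (fromMaybe (c 0) t)) (sym at≡y) ⟩
    just (limit j)    ∎
    where open ≡-Reasoning

  limit-prefix : ∀ m → IsPrefixOfSeq (P m) limit
  limit-prefix m = segment-from-at limit 0 (P m) (P-reads-limit m)

  -- The closure of the length-n prefix of the limit is the first member of length ≥ n.
  prefix-closure : ∀ i n → n ≤ length (P i) →
                   ∃ λ p → IsPalClosure (segment limit 0 n) p × IsPrefixOfSeq p limit
  prefix-closure zero n n≤P₀ with n≤0⇒n≡0 (subst (λ t → n ≤ length t) P₀ n≤P₀)
  ... | refl = [] , palindrome-closure refl , refl
  prefix-closure (suc i) n n≤P with n ≤? length (P i)
  ... | yes n≤Pi = prefix-closure i n n≤Pi
  ... | no n≰Pi  = P (suc i) , (proj₁ (step i) , u-prefix , minimal) , limit-prefix (suc i)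
    where
    u : Word k
    u = segment limit 0 n
    u-prefix : IsPrefixOf u (P (suc i))
    u-prefix = prefix-from-at u (P (suc i)) λ j j<u →
      let j<n = subst (j <_) (length-segment limit 0 n) j<u in
      trans (at-segment limit 0 n j j<n) (sym (P-reads-limit (suc i) j (≤-trans j<n n≤P)))
    Pic-prefix : IsPrefixOf (P i ++ c i ∷ []) u
    Pic-prefix = prefix-from-at (P i ++ c i ∷ []) u λ j j<Pic →
      let j<n = ≤-trans (subst (j <_) (length-snoc (P i) (c i)) j<Pic) (≰⇒> n≰Pi) in
      trans (sym (at-of-prefix (extends i) j<Pic))
            (trans (P-reads-limit (suc i) j (≤-trans j<n n≤P)) (sym (at-segment limit 0 n j j<n)))
    minimal : ∀ q → IsPalindrome q → IsPrefixOf u q → length (P (suc i)) ≤ length q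
    minimal q q-pal u-prefix-q = proj₂ (proj₂ (step i)) q q-pal (prefix-trans Pic-prefix u-prefix-q)

  limit-standard : IsStandardEpisturmian limit
  limit-standard n = prefix-closure n n (length-lower n)

  limit-episturmian : IsEpisturmian limit
  limit-episturmian = limit , limit-standard , λ _ → (λ f → f) , (λ f → f)

  limit-factor : ∀ {w} i → Infix w (P i) → IsFactorOfSeq w limit
  limit-factor {w} i (L , M , Pi≡LwM) = length L , segment-from-at limit (length L) w letters
    where
    Pi-length : length (P i) ≡ length L + (length w + length M)
    Pi-length = trans (cong length Pi≡LwM) (trans (length-++ L) (cong (length L +_) (length-++ w)))
    letters : ∀ j → j < length w → at w j ≡ just (limit (length L + j))
    letters j j<w = begin
      at w j                            ≡⟨ sym (at-++ˡ w M j j<w) ⟩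
      at (w ++ M) j                     ≡⟨ sym (at-++ʳ L (w ++ M) j) ⟩
      at (L ++ (w ++ M)) (length L + j) ≡⟨ cong (λ t → at t (length L + j)) (sym Pi≡LwM) ⟩
      at (P i) (length L + j)           ≡⟨ P-reads-limit i (length L + j) bound ⟩
      just (limit (length L + j))       ∎
      where
      open ≡-Reasoning
      bound : length L + j < length (P i)
      bound = subst (length L + j <_) (sym Pi-length)
                (+-monoʳ-< (length L) (≤-trans j<w (m≤m+n (length w) (length M))))

power : List A → ℕ → List A
power y zero    = []
power y (suc n) = y ++ power y n

power-comm : ∀ (y : List A) n → power y n ++ y ≡ y ++ power y n
power-comm y zero    = sym (++-identityʳ y)
power-comm y (suc n) = trans (++-assoc y (power y n) y) (cong (y ++_) (power-comm y n))

power-image : ∀ {k} (g : Gen k) y n → power (applyGen g y) n ≡ applyGen g (power y n)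
power-image g y zero    = refl
power-image g y (suc n) =
  trans (cong (applyGen g y ++_) (power-image g y n)) (sym (concatMap-++ (genLetter g) y (power y n)))

letter-power-palindrome : ∀ (b : A) n → IsPalindrome (power (b ∷ []) n)
letter-power-palindrome b zero    = refl
letter-power-palindrome b (suc n) =
  trans (unfold-reverse b (power (b ∷ []) n))
        (trans (cong (_++ b ∷ []) (letter-power-palindrome b n)) (power-comm (b ∷ []) n))

constant-chain : ∀ {k} → Letter k → PalChain k
constant-chain b = record
  { P = power (b ∷ []) ; c = λ _ → b ; P₀ = refl
  ; step = λ i → subst (λ u → IsPalClosure u (b ∷ power (b ∷ []) i)) (sym (power-comm (b ∷ []) i))
                       (palindrome-closure (letter-power-palindrome b (suc i))) }

-- θ_ab renames letters by the transposition of a and b, so it maps chains to chains.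
module Rename {k : ℕ} (a b : Letter k) where

  θ-letter : ∀ y → genLetter (θ a b) y ≡ transpose a b y ∷ []
  θ-letter y with y ≟ a
  ... | yes _ = refl
  ... | no _ with y ≟ b
  ...   | yes _ = refl
  ...   | no _  = refl

  θ-map : ∀ w → applyGen (θ a b) w ≡ map (transpose a b) w
  θ-map []      = refl
  θ-map (y ∷ w) = cong₂ _++_ (θ-letter y) (θ-map w)

  θ-chain : PalChain k → PalChain k
  θ-chain K = record
    { P = λ i → map (transpose a b) (P i) ; c = λ i → transpose a b (c i)
    ; P₀ = cong (map (transpose a b)) P₀
    ; step = λ i → subst (λ u → IsPalClosure u (map (transpose a b) (P (suc i))))
                         (map-++ (transpose a b) (P i) (c i ∷ []))
                         (closure-map (transpose a b) (transpose b a) (λ _ → transpose-inverse b a) (step i)) }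
    where open PalChain K

ψ-chain : ∀ {k} (x : Letter k) → PalChain k → PalChain k
ψ-chain {k} x K = record { P = P′ ; c = c′ ; P₀ = refl ; step = step′ }
  where
  open PalChain K
  open PsiMorphism x
  P′ : ℕ → Word k
  P′ zero    = []
  P′ (suc i) = Ψ (P i) ++ x ∷ []
  c′ : ℕ → Letter k
  c′ zero    = x
  c′ (suc i) = c i
  step′ : ∀ i → IsPalClosure (P′ i ++ c′ i ∷ []) (P′ (suc i))
  step′ zero    = subst (λ t → IsPalClosure (x ∷ []) (Ψ t ++ x ∷ [])) (sym P₀) (palindrome-closure refl)
  step′ (suc i) = Justin.justin x (P i) (c i) (P (suc i)) (step i)

Realises : ∀ {k} → PalChain k → Word k → Set
Realises K y = ∀ n → ∃ λ i → Infix (power y n) (PalChain.P K i)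

infix-image : ∀ {k} (g : Gen k) {u v} → Infix u v → Infix (applyGen g u) (applyGen g v)
infix-image g {u} (L , M , refl) =
  applyGen g L , applyGen g M ,
  trans (concatMap-++ (genLetter g) L (u ++ M)) (cong (applyGen g L ++_) (concatMap-++ (genLetter g) u M))

power-infix-image : ∀ {k} (g : Gen k) y n {v} → Infix (power y n) v → Infix (power (applyGen g y) n) (applyGen g v)
power-infix-image g y n occ = subst (λ t → Infix t _) (sym (power-image g y n)) (infix-image g occ)

constant-realises : ∀ {k} (b : Letter k) → Realises (constant-chain b) (b ∷ [])
constant-realises b n = n , [] , [] , sym (++-identityʳ _)

θ-realises : ∀ {k} (a b : Letter k) {K y} → Realises K y → Realises (Rename.θ-chain a b K) (applyGen (θ a b) y)
θ-realises a b {K} {y} occ n with occ n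
... | i , o = i , subst (Infix _) (Rename.θ-map a b (PalChain.P K i)) (power-infix-image (θ a b) y n o)

ψ-realises : ∀ {k} (x : Letter k) {K y} → Realises K y → Realises (ψ-chain x K) (applyGen (ψ x) y)
ψ-realises x {K} {y} occ n with occ n
... | i , o = suc i , infix-snoc x (power-infix-image (ψ x) y n o)

-- For ψ̄_x use x ψ̄_x(P_i) = ψ_x(P_i) x.
ψ̄-realises : ∀ {k} (x : Letter k) {K y} → Realises K y → Realises (ψ-chain x K) (applyGen (ψ̄ x) y)
ψ̄-realises x {K} {y} occ n with occ n
... | i , o = suc i , subst (Infix _) (PsiMorphism.Ψ-conjugate x (PalChain.P K i))
                             (infix-cons x (power-infix-image (ψ̄ x) y n o))

epichristoffel-realised : ∀ {k} (f : List (Gen k)) a → ∃ λ K → Realises K (applyMorphism f (a ∷ []))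
epichristoffel-realised []          a = constant-chain a , constant-realises a
epichristoffel-realised (θ b b′ ∷ f) a with epichristoffel-realised f a
... | K , occ = Rename.θ-chain b b′ K , θ-realises b b′ {K} {applyMorphism f (a ∷ [])} occ
epichristoffel-realised (ψ x ∷ f)   a with epichristoffel-realised f a
... | K , occ = ψ-chain x K , ψ-realises x {K} {applyMorphism f (a ∷ [])} occ
epichristoffel-realised (ψ̄ x ∷ f)   a with epichristoffel-realised f a
... | K , occ = ψ-chain x K , ψ̄-realises x {K} {applyMorphism f (a ∷ [])} occ

period-shift-prefix : ∀ {w : List A} {p} → IsPeriod w p → IsPrefixOf (drop p w) w
period-shift-prefix {w = w} {p} (_ , periodic) = prefix-from-at (drop p w) w λ i i< →
  trans (at-drop p w i) (sym (periodic i (length-drop-bound p w i i<)))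

period-power-prefix : ∀ {w : List A} {p} → IsPeriod w p → ∀ n → IsPrefixOf w (power (take p w) n ++ w)
period-power-prefix {w = w} per zero    = [] , ++-identityʳ w
period-power-prefix {w = w} {p} per (suc n) =
  prefix-trans one-period
    (subst (IsPrefixOf (z ++ w)) (sym (++-assoc z (power z n) w)) (prefix-++ˡ z (period-power-prefix per n)))
  where
  z : List _
  z = take p w
  one-period : IsPrefixOf w (z ++ w)
  one-period = subst (λ t → IsPrefixOf t (z ++ w)) (take++drop≡id p w) (prefix-++ˡ z (period-shift-prefix per))

length-power : ∀ {z : List A} → 1 ≤ length z → ∀ n → n ≤ length (power z n)
length-power         z-pos zero    = z≤n
length-power {z = z} z-pos (suc n) = subst (suc n ≤_) (sym (length-++ z)) (+-mono-≤ z-pos (length-power z-pos n))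

take-nonempty : ∀ (w : List A) p → w ≢ [] → 1 ≤ p → 1 ≤ length (take p w)
take-nonempty []      _       w≢[] _  = ⊥-elim (w≢[] refl)
take-nonempty (c ∷ w) (suc p) _    _  = s≤s z≤n

period-root-power : ∀ {w : List A} {p} → w ≢ [] → IsPeriod w p → IsPrefixOf w (power (take p w) (length w))
period-root-power {w = w} {p} w≢[] per =
  prefix-of-++ w _ (length-power (take-nonempty w p w≢[] (proj₁ per)) (length w))
                   (proj₂ (period-power-prefix per (length w)))

theorem4p11 : (k : ℕ) (w z : Word k) → w ≢ [] → IsFractionaryRoot w z →
    IsCEpichristoffel z → ∃ λ (t : Seq k) → IsEpisturmian t × IsFactorOfSeq w t
theorem4p11 k w z w≢[] (p , (p-period , _) , z≡root) (f , a , fa≡z) with epichristoffel-realised f a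
... | K , realises with realises (length w)
... | i , occurs = limit , limit-episturmian , limit-factor i (prefix-infix w-prefix root-power-occurs)
  where
  open ChainLimit K
  w-prefix : IsPrefixOf w (power (take p w) (length w))
  w-prefix = period-root-power w≢[] p-period
  root-power-occurs : Infix (power (take p w) (length w)) (PalChain.P K i)
  root-power-occurs = subst (λ y → Infix (power y (length w)) (PalChain.P K i)) (trans fa≡z z≡root) occurs
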